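{- For all integers $j\geq1$ and $k\geq1$, \[ \pi_5(a(2j-1,k))\geq j+\left\lfloor\frac{5k-5}{2}\right\rfloor,\qquad \pi_5(a(2j,k))\geq j+\left\lfloor\frac{5k-3}{2}\right\rfloor. \]
   Context: $\pi_5(n)$ denotes the exponent of the highest power of $5$ dividing $n$, with $\pi_5(0)=+\infty$. The integers $m(i,j)$ ($i,j\geq1$) are defined by: $m(1,1)=5$, $m(2,1)=10$, $m(3,1)=9$, $m(4,1)=4$, $m(5,1)=1$, $m(i,1)=0$ for $i\geq6$; and for $j\geq2$, $i\geq1$, $m(i,j)=25m(i-1,j-1)+25m(i-2,j-1)+15m(i-3,j-1)+5m(i-4,j-1)+m(i-5,j-1)$, with $m(i',j')=0$ whenever $i'\leq0$. The integers $a(j,k)$ ($j,k\geq1$) are defined by $a(1,1)=10$, $a(1,2)=125$, $a(1,k)=0$ for $k\geq3$, and $a(j+1,k)=\sum_{i\geq1}a(j,i)m(6i,i+k)$ if $j$ is odd, $a(j+1,k)=\sum_{i\geq1}a(j,i)m(6i+2,i+k)$ if $j$ is even. -}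

module Defs where

open import Data.Nat using (ℕ; zero; suc; _+_; _*_; _∸_; _^_)
open import Data.Nat.Divisibility using (_∣_)
open import Data.Nat.DivMod using (_/_)
open import Data.List using (List; map; upTo)
open import Data.Nat.ListAction using (sum)
open import Data.Bool using (Bool; true; false; if_then_else_)

-- π₅(n) ≥ N, for n ∈ ℕ and N ∈ ℕ, with the convention π₅(0) = +∞:
-- this holds exactly when 5^N divides n.
_≤π₅_ : ℕ → ℕ → Set
N ≤π₅ n = 5 ^ N ∣ n

-- m i j  (meaningful for i, j ≥ 1; m i j = 0 when i ≤ 0, and we set m i 0 = 0).
-- All values are nonnegative integers, so ℕ is used.
m : ℕ → ℕ → ℕ
m zero _ = 0
m (suc i) zero = 0
m 1 1 = 5
m 2 1 = 10
m 3 1 = 9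
m 4 1 = 4
m 5 1 = 1
m (suc i) 1 = 0
m (suc i) (suc (suc j)) =
  25 * m i (suc j) + 25 * m (suc i ∸ 2) (suc j) + 15 * m (suc i ∸ 3) (suc j)
  + 5 * m (suc i ∸ 4) (suc j) + m (suc i ∸ 5) (suc j)

odd : ℕ → Bool
odd zero = false
odd (suc n) with odd n
... | true = false
... | false = true

Σ₁ : ℕ → (ℕ → ℕ) → ℕ
Σ₁ n f = sum (map (λ i → f (suc i)) (upTo n))

-- a j k  (meaningful for j, k ≥ 1; we set a 0 k = 0).
-- The sum over i ≥ 1 is truncated at i = 5k: since m i' j' = 0 whenever
-- i' > 5 j', the terms m(6i, i+k) and m(6i+2, i+k) vanish for i > 5k.
a : ℕ → ℕ → ℕ
a zero _ = 0
a (suc zero) 1 = 10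
a (suc zero) 2 = 125
a (suc zero) _ = 0
a (suc (suc j)) k =
  Σ₁ (5 * k) (λ i → a (suc j) i *
    m (if odd (suc j) then 6 * i else 6 * i + 2) (i + k))

-- By induction on j, π₅ m(i,j) ≥ ⌊(5j − i − 1)/2⌋: in the recurrence the shifted term
-- m(i − t, j − 1) carries a factor 5^e with (e,t) ∈ {(2,1),(2,2),(1,3),(1,4),(0,5)}, and
-- 2e + t ≥ 5 makes up for lowering j by one.
-- For a, a(n+1,k) = Σᵢ a(n,i) m(6i + δ, i + k) with δ ∈ {0,2}. From i to i + 1 the inductive
-- bound on a(n,i) gains 5/2 and the bound on m(6i + δ, i + k) loses 1/2, so adding the two factor
-- bounds (at the cost of one unit of rounding) gives the claimed bound on a(n+1,k) with 2(i − 1)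
-- to spare; this is where the sum starting at i = 1 matters.
module Submission where

open import Defs
open import Data.Bool using (true; false; not; if_then_else_)
open import Data.List using (List; []; _∷_; map; upTo)
open import Data.Nat
open import Data.Nat.DivMod using (_/_; _%_; m/n*n≤m; m≡m%n+[m/n]*n; m%n<n)
open import Data.Nat.Divisibility
open import Data.Nat.ListAction using (sum)
open import Data.Nat.Properties
open import Data.Nat.Tactic.RingSolver using (solve)
open import Data.Product using (_×_; _,_; ∃-syntax)
open import Relation.Binary.PropositionalEquality
open import Relation.Nullary using (yes; no)

private variable
  c c′ x y A N L L′ : ℕ

≤π₅-antitone : A ≤ N → N ≤π₅ x → A ≤π₅ x
≤π₅-antitone {A} A≤N 5^N∣x with m≤n⇒∃[o]m+o≡n A≤N
... | o , refl = ∣-trans (subst (5 ^ A ∣_) (sym (^-distribˡ-+-* 5 A o)) (m∣m*n (5 ^ o))) 5^N∣x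

≤π₅-* : A ≤π₅ x → N ≤π₅ y → (A + N) ≤π₅ (x * y)
≤π₅-* {A} {N = N} 5^A∣x 5^N∣y =
  subst (_∣ _) (sym (^-distribˡ-+-* 5 A N)) (*-pres-∣ 5^A∣x 5^N∣y)

∣-sum-map : ∀ {d} (f : ℕ → ℕ) (xs : List ℕ) → (∀ n → d ∣ f n) → d ∣ sum (map f xs)
∣-sum-map f []       d∣f = _ ∣0
∣-sum-map f (n ∷ xs) d∣f = ∣m∣n⇒∣m+n (d∣f n) (∣-sum-map f xs d∣f)

2*[n/2]≤n : ∀ n → 2 * (n / 2) ≤ n
2*[n/2]≤n n = subst (_≤ n) (*-comm (n / 2) 2) (m/n*n≤m n 2)

n≤1+2*[n/2] : ∀ n → n ≤ suc (2 * (n / 2))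
n≤1+2*[n/2] n = begin
  n                      ≡⟨ m≡m%n+[m/n]*n n 2 ⟩
  n % 2 + n / 2 * 2      ≤⟨ +-mono-≤ (≤-pred (m%n<n n 2)) (≤-reflexive (*-comm (n / 2) 2)) ⟩
  suc (2 * (n / 2))      ∎
  where open ≤-Reasoning

2*[n+[L∸c]/2]+c≤2*n+L : ∀ n L c → c ≤ L → 2 * (n + (L ∸ c) / 2) + c ≤ 2 * n + L
2*[n+[L∸c]/2]+c≤2*n+L n L c c≤L = begin
  2 * (n + q) + c          ≡⟨ cong (_+ c) (*-distribˡ-+ 2 n q) ⟩
  2 * n + 2 * q + c        ≡⟨ +-assoc (2 * n) (2 * q) c ⟩
  2 * n + (2 * q + c)      ≤⟨ +-monoʳ-≤ (2 * n) (+-monoˡ-≤ c (2*[n/2]≤n (L ∸ c))) ⟩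
  2 * n + (L ∸ c + c)      ≡⟨ cong (2 * n +_) (m∸n+n≡m c≤L) ⟩
  2 * n + L                ∎
  where
  open ≤-Reasoning
  q = (L ∸ c) / 2

-- ⌊ L − c ⌋/2≤π₅ x says ⌊(L − c)/2⌋ ≤ π₅(x); the subtraction is never carried out, so the
-- bound is vacuous when L < c and all the bookkeeping below is additive.
⌊_−_⌋/2≤π₅_ : ℕ → ℕ → ℕ → Set
⌊ L − c ⌋/2≤π₅ x = ∀ N → 2 * N + c ≤ L → N ≤π₅ x

halfBound-intro : A ≤π₅ x → L ≤ 2 * A + suc c → ⌊ L − c ⌋/2≤π₅ x
halfBound-intro {A} {L = L} {c} 5^A∣x L≤ N 2N+c≤L = ≤π₅-antitone N≤A 5^A∣x
  where
  2N<2[1+A] : 2 * N < 2 * suc A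
  2N<2[1+A] = begin-strict
    2 * N              ≤⟨ +-cancelʳ-≤ c _ _ (≤-trans 2N+c≤L (subst (L ≤_) (+-suc (2 * A) c) L≤)) ⟩
    suc (2 * A)        <⟨ n<1+n _ ⟩
    suc (suc (2 * A))  ≡⟨ sym (*-suc 2 A) ⟩
    2 * suc A          ∎
    where open ≤-Reasoning
  N≤A : N ≤ A
  N≤A = ≤-pred (*-cancelˡ-< 2 N (suc A) 2N<2[1+A])

halfBound-witness : ⌊ L − c ⌋/2≤π₅ x → ∃[ q ] q ≤π₅ x × L ≤ 2 * q + suc c
halfBound-witness {L} {c} bound = q , 5^q∣x , L≤2q+1+c
  where
  open ≤-Reasoning
  q = (L ∸ c) / 2

  5^q∣x : q ≤π₅ _
  5^q∣x with c ≤? L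
  ... | yes c≤L = bound q (2*[n+[L∸c]/2]+c≤2*n+L 0 L c c≤L)
  ... | no  c≰L rewrite m≤n⇒m∸n≡0 (<⇒≤ (≰⇒> c≰L)) = 1∣ _

  L≤2q+1+c : L ≤ 2 * q + suc c
  L≤2q+1+c = begin
    L                ≤⟨ m≤n+m∸n L c ⟩
    c + (L ∸ c)      ≤⟨ +-monoʳ-≤ c (n≤1+2*[n/2] (L ∸ c)) ⟩
    c + suc (2 * q)  ≡⟨ +-comm c _ ⟩
    suc (2 * q) + c  ≡⟨ sym (+-suc _ c) ⟩
    2 * q + suc c    ∎

halfBound-* : ⌊ L − c ⌋/2≤π₅ x → ⌊ L′ − c′ ⌋/2≤π₅ y → ⌊ L + L′ − suc (c + c′) ⌋/2≤π₅ (x * y)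
halfBound-* {L} {c} {L′ = L′} {c′} bx by with halfBound-witness bx | halfBound-witness by
... | q , 5^q∣x , L≤ | q′ , 5^q′∣y , L′≤ =
  halfBound-intro {q + q′} (≤π₅-* {q} {N = q′} 5^q∣x 5^q′∣y) (begin
    L + L′                                 ≤⟨ +-mono-≤ L≤ L′≤ ⟩
    (2 * q + suc c) + (2 * q′ + suc c′)    ≡⟨ solve (q ∷ q′ ∷ c ∷ c′ ∷ []) ⟩
    2 * (q + q′) + suc (suc (c + c′))      ∎)
  where open ≤-Reasoning

halfBound-5^* : ∀ e → ⌊ L − c ⌋/2≤π₅ x → ⌊ 2 * e + L − c ⌋/2≤π₅ (5 ^ e * x)
halfBound-5^* {L} {c} e bx with halfBound-witness bx
... | q , 5^q∣x , L≤ =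
  halfBound-intro {e + q} (≤π₅-* {e} {N = q} ∣-refl 5^q∣x) (begin
    2 * e + L                  ≤⟨ +-monoʳ-≤ (2 * e) L≤ ⟩
    2 * e + (2 * q + suc c)    ≡⟨ solve (e ∷ q ∷ c ∷ []) ⟩
    2 * (e + q) + suc c        ∎)
  where open ≤-Reasoning

halfBound-weaken : c + L′ ≤ L + c′ → ⌊ L − c ⌋/2≤π₅ x → ⌊ L′ − c′ ⌋/2≤π₅ x
halfBound-weaken {c} {L′} {L} {c′} le bx N 2N+c′≤L′ = bx N (+-cancelʳ-≤ c′ _ _ (begin
  2 * N + c + c′     ≡⟨ solve (N ∷ c ∷ c′ ∷ []) ⟩
  c + (2 * N + c′)   ≤⟨ +-monoʳ-≤ c 2N+c′≤L′ ⟩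
  c + L′             ≤⟨ le ⟩
  L + c′             ∎))
  where open ≤-Reasoning

halfBound-+ : ⌊ L − c ⌋/2≤π₅ x → ⌊ L − c ⌋/2≤π₅ y → ⌊ L − c ⌋/2≤π₅ (x + y)
halfBound-+ bx by N le = ∣m∣n⇒∣m+n (bx N le) (by N le)

halfBound-Σ₁ : ∀ n f → (∀ i → ⌊ L − c ⌋/2≤π₅ f (suc i)) → ⌊ L − c ⌋/2≤π₅ Σ₁ n f
halfBound-Σ₁ n f bf N le = ∣-sum-map (λ i → f (suc i)) (upTo n) (λ i → bf i N le)

m-suc-suc : ∀ i j → m (suc i) (suc (suc j)) ≡
  25 * m i (suc j) + 25 * m (suc i ∸ 2) (suc j) + 15 * m (suc i ∸ 3) (suc j)
  + 5 * m (suc i ∸ 4) (suc j) + m (suc i ∸ 5) (suc j)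
m-suc-suc 0 j = refl
m-suc-suc 1 j = refl
m-suc-suc 2 j = refl
m-suc-suc 3 j = refl
m-suc-suc 4 j = refl
m-suc-suc (suc (suc (suc (suc (suc i))))) j = refl

module _ {j} (m-bound-j : ∀ i → ⌊ 5 * j − suc i ⌋/2≤π₅ m i j) where

  m-∸-bound : ∀ i t → ⌊ t + 5 * j − suc i ⌋/2≤π₅ m (i ∸ t) j
  m-∸-bound i t with t ≤? i
  ... | yes t≤i = halfBound-weaken (≤-reflexive (begin
    suc (i ∸ t) + (t + 5 * j)   ≡⟨ cong suc (sym (+-assoc (i ∸ t) t (5 * j))) ⟩
    suc (i ∸ t + t + 5 * j)     ≡⟨ cong (λ n → suc (n + 5 * j)) (m∸n+n≡m t≤i) ⟩
    suc i + 5 * j               ≡⟨ +-comm (suc i) (5 * j) ⟩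
    5 * j + suc i               ∎)) (m-bound-j (i ∸ t))
    where open ≡-Reasoning
  ... | no  t≰i rewrite m≤n⇒m∸n≡0 (<⇒≤ (≰⇒> t≰i)) = λ N _ → (5 ^ N) ∣0

  m-term-bound : ∀ i e t → 5 ≤ 2 * e + t → ⌊ 5 + 5 * j − suc i ⌋/2≤π₅ (5 ^ e * m (i ∸ t) j)
  m-term-bound i e t 5≤2e+t = halfBound-weaken (begin
    suc i + (5 + 5 * j)               ≡⟨ +-comm (suc i) _ ⟩
    5 + 5 * j + suc i                 ≤⟨ +-monoˡ-≤ (suc i) (+-monoˡ-≤ (5 * j) 5≤2e+t) ⟩
    2 * e + t + 5 * j + suc i         ≡⟨ cong (_+ suc i) (+-assoc (2 * e) t (5 * j)) ⟩
    2 * e + (t + 5 * j) + suc i       ∎) (halfBound-5^* e (m-∸-bound i t))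
    where open ≤-Reasoning

m-bound-suc-suc : ∀ {j} → (∀ i → ⌊ 5 * suc j − suc i ⌋/2≤π₅ m i (suc j)) →
                  ∀ i → ⌊ 5 * suc (suc j) − suc (suc i) ⌋/2≤π₅ m (suc i) (suc (suc j))
m-bound-suc-suc {j} m-bound-j i =
  subst₂ (λ L x → ⌊ L − suc (suc i) ⌋/2≤π₅ x) (sym (*-suc 5 (suc j))) (sym (m-suc-suc i j))
    (halfBound-+ (halfBound-+ (halfBound-+ (halfBound-+
      (term 2 1 ≤-refl)
      (term 2 2 (n≤1+n 5)))
      15*term)
      (term 1 4 (n≤1+n 5)))
      (m-∸-bound m-bound-j (suc i) 5))
  where
  term = m-term-bound m-bound-j (suc i)

  15*term : ⌊ 5 + 5 * suc j − suc (suc i) ⌋/2≤π₅ (15 * m (suc i ∸ 3) (suc j))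
  15*term N le = subst (5 ^ N ∣_) (sym (*-assoc 3 5 (m (suc i ∸ 3) (suc j))))
    (∣n⇒∣m*n 3 (term 1 3 ≤-refl N le))

m-bound : ∀ j i → ⌊ 5 * j − suc i ⌋/2≤π₅ m i j
m-bound j       zero N _ = (5 ^ N) ∣0
m-bound zero    (suc i) N _ = (5 ^ N) ∣0
m-bound 1 1 = halfBound-intro {1} ∣-refl ≤-refl
m-bound 1 2 = halfBound-intro {1} (divides 2 refl) (n≤1+n 5)
m-bound 1 (suc (suc (suc i))) = halfBound-intro {0} (1∣ _) (m≤m+n 5 i)
m-bound (suc (suc j)) (suc i) = m-bound-suc-suc (m-bound (suc j)) i

odd-suc : ∀ n → odd (suc n) ≡ not (odd n)
odd-suc n with odd n
... | true  = refl
... | false = refl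

odd-1+2* : ∀ j → odd (1 + 2 * j) ≡ true
odd-2+2* : ∀ j → odd (2 + 2 * j) ≡ false

odd-1+2* zero    = refl
odd-1+2* (suc j) = begin
  odd (1 + 2 * suc j)    ≡⟨ cong (λ n → odd (suc n)) (*-suc 2 j) ⟩
  odd (1 + (2 + 2 * j))  ≡⟨ odd-suc (2 + 2 * j) ⟩
  not (odd (2 + 2 * j))  ≡⟨ cong not (odd-2+2* j) ⟩
  true                   ∎
  where open ≡-Reasoning

odd-2+2* j = trans (odd-suc (1 + 2 * j)) (cong not (odd-1+2* j))

a-even-unfold : ∀ j k → a (2 + 2 * j) k ≡ Σ₁ (5 * k) (λ i → a (1 + 2 * j) i * m (6 * i) (i + k))
a-even-unfold j k =
  cong (λ b → Σ₁ (5 * k) (λ i → a (1 + 2 * j) i * m (if b then 6 * i else 6 * i + 2) (i + k)))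
       (odd-1+2* j)

a-odd-unfold : ∀ j k → a (1 + 2 * suc j) k ≡ Σ₁ (5 * k) (λ i → a (2 + 2 * j) i * m (6 * i + 2) (i + k))
a-odd-unfold j k = begin
  a (1 + 2 * suc j) k  ≡⟨ cong (λ n → a (suc n) k) (*-suc 2 j) ⟩
  a (3 + 2 * j) k      ≡⟨ cong (λ b → Σ₁ (5 * k) (λ i →
                                  a (2 + 2 * j) i * m (if b then 6 * i else 6 * i + 2) (i + k)))
                               (odd-2+2* j) ⟩
  Σ₁ (5 * k) (λ i → a (2 + 2 * j) i * m (6 * i + 2) (i + k)) ∎
  where open ≡-Reasoning

a-odd-bound : ∀ j k → ⌊ 2 * suc j + 5 * k − 5 ⌋/2≤π₅ a (1 + 2 * j) k
a-even-bound : ∀ j k → ⌊ 2 * suc j + 5 * k − 3 ⌋/2≤π₅ a (2 + 2 * j) k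

a-odd-bound zero 0                   N _ = (5 ^ N) ∣0
a-odd-bound zero 1                       = halfBound-intro {1} (divides 2 refl) (n≤1+n 7)
a-odd-bound zero 2                       = halfBound-intro {3} ∣-refl ≤-refl
a-odd-bound zero (suc (suc (suc k))) N _ = (5 ^ N) ∣0
a-odd-bound (suc j) k =
  subst (⌊ 2 * suc (suc j) + 5 * k − 5 ⌋/2≤π₅_) (sym (a-odd-unfold j k))
    (halfBound-Σ₁ (5 * k) (λ i → a (2 + 2 * j) i * m (6 * i + 2) (i + k)) summand)
  where
  summand : ∀ i → ⌊ 2 * suc (suc j) + 5 * k − 5 ⌋/2≤π₅
                    (a (2 + 2 * j) (suc i) * m (6 * suc i + 2) (suc i + k))
  summand i = halfBound-weaken slack
    (halfBound-* (a-even-bound j (suc i)) (m-bound (suc i + k) (6 * suc i + 2)))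
    where
    slack : suc (3 + suc (6 * suc i + 2)) + (2 * suc (suc j) + 5 * k)
          ≤ 2 * suc j + 5 * suc i + 5 * (suc i + k) + 5
    slack = m+n≤o⇒m≤o _ {4 * i} (≤-reflexive (solve (i ∷ j ∷ k ∷ [])))

a-even-bound j k =
  subst (⌊ 2 * suc j + 5 * k − 3 ⌋/2≤π₅_) (sym (a-even-unfold j k))
    (halfBound-Σ₁ (5 * k) (λ i → a (1 + 2 * j) i * m (6 * i) (i + k)) summand)
  where
  summand : ∀ i → ⌊ 2 * suc j + 5 * k − 3 ⌋/2≤π₅
                    (a (1 + 2 * j) (suc i) * m (6 * suc i) (suc i + k))
  summand i = halfBound-weaken slack
    (halfBound-* (a-odd-bound j (suc i)) (m-bound (suc i + k) (6 * suc i)))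
    where
    slack : suc (5 + suc (6 * suc i)) + (2 * suc j + 5 * k)
          ≤ 2 * suc j + 5 * suc i + 5 * (suc i + k) + 3
    slack = m+n≤o⇒m≤o _ {4 * i} (≤-reflexive (solve (i ∷ j ∷ k ∷ [])))

lemma4p3 : (j k : ℕ) → 1 ≤ j → 1 ≤ k →
    ((j + (5 * k ∸ 5) / 2) ≤π₅ a (2 * j ∸ 1) k)
      × ((j + (5 * k ∸ 3) / 2) ≤π₅ a (2 * j) k)
lemma4p3 (suc j) k _ 1≤k =
    subst (λ n → (suc j + (5 * k ∸ 5) / 2) ≤π₅ a n k) (sym (cong (_∸ 1) (*-suc 2 j)))
      (a-odd-bound j k _ (2*[n+[L∸c]/2]+c≤2*n+L (suc j) (5 * k) 5 5≤5k))
  , subst (λ n → (suc j + (5 * k ∸ 3) / 2) ≤π₅ a n k) (sym (*-suc 2 j))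
      (a-even-bound j k _ (2*[n+[L∸c]/2]+c≤2*n+L (suc j) (5 * k) 3 (≤-trans (m≤m+n 3 2) 5≤5k)))
  where
  5≤5k : 5 ≤ 5 * k
  5≤5k = *-monoʳ-≤ 5 1≤k
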